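{- Let $n,h,i$ be integers with $1<i\le h\le n-1$. In the $h$-AO-SP with $n$ online candidates, let Algorithm 1 be run against an arbitrary adversarial ordering strategy. Then $$\mathbb{E}[\mathrm{ALG}\mid \mathcal{O}_i]\ \ge\ \frac{h}{n}\,\mathbb{E}[\mathrm{OPT}\mid \mathcal{H}_{i-1}].$$
   Context: The $h$-AO-SP, for integers $n\ge1$, $h\ge0$: an adversary picks a set $C$ of $n+h$ candidates with values in $\mathbb{R}_{\ge0}$, sorted as $\alpha_1>\alpha_2>\dots>\alpha_{n+h}$ (ties broken by a fixed consistent tie-breaker). A subset $H\subseteq C$ of cardinality $h$ is drawn uniformly at random and given to the online player upfront together with $n$; $O=C\setminus H$. The adversary orders $O$ as $c_1,\dots,c_n$ (possibly depending on $H$); candidates are revealed one by one and the player must irrevocably accept or reject each upon arrival, accepting terminates. $\mathrm{ALG}$ is the value of the accepted candidate (0 if none), $\mathrm{OPT}=\max O$. $\mathcal{O}_i$ is the event $\alpha_1,\dots,\alpha_i\in O$ and $\mathcal{H}_i$ is the event $\alpha_1,\dots,\alpha_i\in H$. Algorithm 1: $T_0\leftarrow H$; at round $\ell$, $T_\ell\leftarrow T_{\ell-1}\cup\{c_\ell\}$, and if $c_\ell=\max T_\ell$, accept $c_\ell$ and terminate.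
   Formalization: The candidate values are non-negative rationals rather than elements of $\mathbb{R}_{\ge0}$. -}

module Defs where

open import Data.Bool using (Bool; true; false; not; _∧_; if_then_else_)
open import Data.Nat using (ℕ; zero; suc; _<ᵇ_; _≡ᵇ_)
open import Data.Fin using (Fin; toℕ)
open import Data.Vec using (Vec; []; _∷_; lookup)
open import Data.List using (List; []; _∷_; map; filterᵇ; foldr; length; _++_)
open import Data.List using (allFin) public
open import Data.Integer using (+_)
open import Data.Rational using (ℚ; 0ℚ; _+_; _*_; _/_; _⊔_)
open import Data.Fin.Subset using (Subset; ∣_∣)

-- Candidates are identified with their rank: Fin m, rank 0 = α₁ (the best).
-- The fixed tie-breaker is the rank order; the value of rank j is α j.

allᵇ : {A : Set} → (A → Bool) → List A → Bool
allᵇ p = foldr (λ x b → p x ∧ b) true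

allSubsets : (m : ℕ) → List (Subset m)
allSubsets zero = [] ∷ []
allSubsets (suc m) = map (true ∷_) (allSubsets m) ++ map (false ∷_) (allSubsets m)

subsetsOfSize : (m h : ℕ) → List (Subset m)
subsetsOfSize m h = filterᵇ (λ H → ∣ H ∣ ≡ᵇ h) (allSubsets m)

outside : {m : ℕ} → Subset m → List (Fin m)
outside {m} H = filterᵇ (λ j → not (lookup H j)) (allFin m)

inside : {m : ℕ} → Subset m → List (Fin m)
inside {m} H = filterᵇ (λ j → lookup H j) (allFin m)

-- c is the maximum of T ∪ {c} (w.r.t. the value order with the rank tie-breaker)
isMaxOver : {m : ℕ} → Fin m → List (Fin m) → Bool
isMaxOver c T = allᵇ (λ t → toℕ c <ᵇ toℕ t) T

runAlg : {m : ℕ} → (Fin m → ℚ) → List (Fin m) → List (Fin m) → ℚ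
runAlg α T [] = 0ℚ
runAlg α T (c ∷ cs) = if isMaxOver c T then α c else runAlg α (c ∷ T) cs

ALG : {m : ℕ} → (Fin m → ℚ) → Subset m → List (Fin m) → ℚ
ALG α H ord = runAlg α (inside H) ord

-- OPT = max O (values are ≥ 0, so 0 is a neutral start)
OPT : {m : ℕ} → (Fin m → ℚ) → Subset m → ℚ
OPT α H = foldr _⊔_ 0ℚ (map α (outside H))

eventO : {m : ℕ} → ℕ → Subset m → Bool
eventO {m} i H = allᵇ (λ j → if toℕ j <ᵇ i then not (lookup H j) else true) (allFin m)

eventH : {m : ℕ} → ℕ → Subset m → Bool
eventH {m} i H = allᵇ (λ j → if toℕ j <ᵇ i then lookup H j else true) (allFin m)

sumℚ : List ℚ → ℚ
sumℚ = foldr _+_ 0ℚ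

average : List ℚ → ℚ
average [] = 0ℚ
average (x ∷ xs) = sumℚ (x ∷ xs) * ((+ 1) / suc (length xs))

-- E[ f | E ] under the uniform distribution on subsets of size h
condExp : (m h : ℕ) → (Subset m → Bool) → (Subset m → ℚ) → ℚ
condExp m h E f = average (map f (filterᵇ E (subsetsOfSize m h)))

frac : ℕ → ℕ → ℚ
frac h zero = 0ℚ
frac h (suc k) = (+ h) / suc k

{-# OPTIONS --safe #-}
module Submission where

-- On 𝒪_i the best candidate is online, so the best sampled candidate has an online candidate c ranked
-- immediately above it.  Algorithm 1 accepts only candidates beating the whole sample, hence ranked no
-- worse than c, and it accepts c if it gets that far; so ALG ≥ α(c), while OPT is α of the best online
-- candidate.  Under ℋ_{i-1} the i-1 best candidates are sampled and under 𝒪_i the i best are online;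
-- discarding the i-1 best on both sides leaves plain averages, over the k-subsets (k = h-i+1) of n+k
-- candidates resp. over the h-subsets of the n+k-1 candidates below the next one.  The inequality
-- (h/n)·avg α(best outside) ≤ avg α(just above best inside) is then proved by induction on k, splitting
-- off the best remaining candidate and comparing its weights via k·C(n,k) = n·C(n-1,k-1) and
-- (n-k)·C(n,k) = n·C(n-1,k).

module _ where

  open import Defs
  open import Data.Bool using (Bool; true; false; not; T; _∧_; if_then_else_)
  open import Data.Bool.Properties using (T?; T-∧)
  open import Data.Empty using (⊥-elim)
  open import Data.Fin using (Fin; zero; suc; toℕ)
  open import Data.Fin.Subset using (Subset; ∣_∣)
  open import Data.Integer as ℤ using (+_)
  import Data.Integer.Properties as ℤ
  open import Data.List using (List; []; _∷_; _++_; map; length; foldr; filterᵇ)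
  open import Data.List.Membership.Propositional using (_∈_)
  open import Data.List.Membership.Propositional.Properties using (∈-allFin; ∈-filter⁺; ∈-filter⁻)
  open import Data.List.Properties using (length-map; length-++; map-++; map-∘; map-cong; map-tabulate; foldr-map; filter-++; filter-none; filter-all; filter-≐; ++-identityʳ; foldr-preservesᵇ)
  open import Data.List.Relation.Binary.Permutation.Propositional using (_↭_; ↭-sym)
  open import Data.List.Relation.Binary.Permutation.Propositional.Properties using (∈-resp-↭)
  open import Data.List.Relation.Unary.All as All using (All; []; _∷_)
  open import Data.List.Relation.Unary.All.Properties using (map⁺)
  open import Data.List.Relation.Unary.Any using (here; there)
  open import Data.Nat as ℕ using (ℕ; zero; suc; z≤n; s≤s)
  open import Data.Nat.Combinatorics using (_C_; k>n⇒nCk≡0; nCk+nC[k+1]≡[n+1]C[k+1]; nC1≡n; nCk≡nC[n∸k])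
  import Data.Nat.Properties as ℕ
  open import Algebra.Properties.CommutativeSemigroup ℕ.*-commutativeSemigroup using (xy∙z≈xz∙y; xy∙z≈zy∙x; xy∙z≈yz∙x; interchange)
  open import Data.Nat.Tactic.RingSolver using (solve-∀)
  open import Data.Product using (∃₂; _×_; _,_; proj₁; proj₂)
  open import Data.Rational using (ℚ; 0ℚ; 1ℚ; _+_; _*_; _/_; _≤_; _⊔_; nonNegative)
  open import Data.Rational.Literals using (fromℤ)
  open import Data.Rational.Properties
  import Data.Rational.Unnormalised as ℚᵘ
  import Data.Rational.Unnormalised.Properties as ℚᵘ
  open import Data.Vec using ([]; _∷_; lookup)
  open import Function using (_∘_)
  open import Function.Bundles using (Equivalence)
  open import Relation.Binary.PropositionalEquality
  open import Relation.Nullary using (yes; no)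

  fromℕ : ℕ → ℚ
  fromℕ k = fromℤ (+ k)

  fromℕ-+ : ∀ a b → fromℕ (a ℕ.+ b) ≡ fromℕ a + fromℕ b
  fromℕ-+ a b = toℚᵘ-injective (ℚᵘ.≃-sym (ℚᵘ.≃-trans (toℚᵘ-homo-+ (fromℕ a) (fromℕ b)) (ℚᵘ.*≡* (begin
    (+ a ℤ.* + 1 ℤ.+ + b ℤ.* + 1) ℤ.* + 1  ≡⟨ ℤ.*-identityʳ _ ⟩
    + a ℤ.* + 1 ℤ.+ + b ℤ.* + 1            ≡⟨ cong₂ ℤ._+_ (ℤ.*-identityʳ (+ a)) (ℤ.*-identityʳ (+ b)) ⟩
    + (a ℕ.+ b)                            ≡⟨ ℤ.*-identityʳ (+ (a ℕ.+ b)) ⟨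
    + (a ℕ.+ b) ℤ.* + 1                    ∎))))
    where open ≡-Reasoning

  fromℕ-* : ∀ a b → fromℕ (a ℕ.* b) ≡ fromℕ a * fromℕ b
  fromℕ-* a b = toℚᵘ-injective (ℚᵘ.≃-sym (ℚᵘ.≃-trans (toℚᵘ-homo-* (fromℕ a) (fromℕ b)) (ℚᵘ.*≡* (begin
    (+ a ℤ.* + b) ℤ.* + 1  ≡⟨ ℤ.*-identityʳ _ ⟩
    + a ℤ.* + b            ≡⟨ ℤ.pos-* a b ⟨
    + (a ℕ.* b)            ≡⟨ ℤ.*-identityʳ (+ (a ℕ.* b)) ⟨
    + (a ℕ.* b) ℤ.* + 1    ∎))))
    where open ≡-Reasoning

  fromℕ-mono-≤ : ∀ {a b} → a ℕ.≤ b → fromℕ a ≤ fromℕ b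
  fromℕ-mono-≤ a≤b = toℚᵘ-cancel-≤ (ℚᵘ.*≤* (ℤ.*-monoʳ-≤-nonNeg (+ 1) (ℤ.+≤+ a≤b)))

  /-*-fromℕ : ∀ a b → (+ a / suc b) * fromℕ (suc b) ≡ fromℕ a
  /-*-fromℕ a b = toℚᵘ-injective (ℚᵘ.≃-trans (toℚᵘ-homo-* (+ a / suc b) (fromℕ (suc b)))
    (ℚᵘ.≃-trans (ℚᵘ.*-congʳ (toℚᵘ-fromℚᵘ (ℚᵘ.mkℚᵘ (+ a) b))) (ℚᵘ.*≡* (begin
    (+ a ℤ.* + suc b) ℤ.* + 1  ≡⟨ ℤ.*-identityʳ _ ⟩
    + a ℤ.* + suc b            ≡⟨ cong (λ d → + a ℤ.* + d) (ℕ.*-identityʳ (suc b)) ⟨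
    + a ℤ.* + (suc b ℕ.* 1)    ∎))))
    where open ≡-Reasoning

  infixr 7 _·_

  _·_ : ℕ → ℚ → ℚ
  k · x = fromℕ k * x

  ·-assoc : ∀ a b x → a · b · x ≡ (a ℕ.* b) · x
  ·-assoc a b x = trans (sym (*-assoc (fromℕ a) (fromℕ b) x)) (cong (_* x) (sym (fromℕ-* a b)))

  ·-monoˡ-≤ : ∀ {a b} x → a ℕ.≤ b → 0ℚ ≤ x → a · x ≤ b · x
  ·-monoˡ-≤ x a≤b 0≤x = *-monoʳ-≤-nonNeg x {{nonNegative 0≤x}} (fromℕ-mono-≤ a≤b)

  ·-monoʳ-≤ : ∀ a {x y} → x ≤ y → a · x ≤ a · y
  ·-monoʳ-≤ a = *-monoˡ-≤-nonNeg (fromℕ a)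

  ·-cancelˡ-≤ : ∀ {a x y} → 0 ℕ.< a → a · x ≤ a · y → x ≤ y
  ·-cancelˡ-≤ {suc a} _ = *-cancelˡ-≤-pos (fromℕ (suc a))

  ·-nonNeg : ∀ a {x} → 0ℚ ≤ x → 0ℚ ≤ a · x
  ·-nonNeg a {x} 0≤x = subst (_≤ a · x) (*-zeroʳ (fromℕ a)) (·-monoʳ-≤ a 0≤x)

  ·-·-monoˡ-≤ : ∀ {a b c d} x → a ℕ.* b ℕ.≤ c ℕ.* d → 0ℚ ≤ x → a · b · x ≤ c · d · x
  ·-·-monoˡ-≤ {a} {b} {c} {d} x ab≤cd 0≤x =
    subst₂ _≤_ (sym (·-assoc a b x)) (sym (·-assoc c d x)) (·-monoˡ-≤ x ab≤cd 0≤x)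

  ·-≤-rescale : ∀ e {a b P P′ Q′ R x y} → 0 ℕ.< e → e ℕ.* P ≡ a ℕ.* P′ → b ℕ.* Q′ ≡ e ℕ.* R → a ℕ.≤ b →
    0ℚ ≤ y → P′ · x ≤ Q′ · y → P · x ≤ R · y
  ·-≤-rescale e {a} {b} {P} {P′} {Q′} {R} {x} {y} 0<e eP≡aP′ bQ′≡eR a≤b 0≤y P′x≤Q′y = ·-cancelˡ-≤ 0<e (begin
    e · P · x       ≡⟨ ·-assoc e P x ⟩
    (e ℕ.* P) · x   ≡⟨ cong (_· x) eP≡aP′ ⟩
    (a ℕ.* P′) · x  ≡⟨ ·-assoc a P′ x ⟨
    a · P′ · x      ≤⟨ ·-monoʳ-≤ a P′x≤Q′y ⟩
    a · Q′ · y      ≤⟨ ·-monoˡ-≤ (Q′ · y) a≤b (·-nonNeg Q′ 0≤y) ⟩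
    b · Q′ · y      ≡⟨ ·-assoc b Q′ y ⟩
    (b ℕ.* Q′) · y  ≡⟨ cong (_· y) bQ′≡eR ⟩
    (e ℕ.* R) · y   ≡⟨ ·-assoc e R y ⟨
    e · R · y       ∎)
    where open ≤-Reasoning

  frac-≤ : ∀ a b {x y} → 0 ℕ.< b → a · x ≤ b · y → frac a b * x ≤ y
  frac-≤ a (suc b) {x} {y} 0<b ax≤by = ·-cancelˡ-≤ 0<b (begin
    suc b · (frac a (suc b) * x)              ≡⟨ *-assoc (fromℕ (suc b)) (frac a (suc b)) x ⟨
    (fromℕ (suc b) * frac a (suc b)) * x      ≡⟨ cong (_* x) (trans (*-comm (fromℕ (suc b)) (frac a (suc b))) (/-*-fromℕ a b)) ⟩
    a · x                                     ≤⟨ ax≤by ⟩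
    suc b · y                                 ∎)
    where open ≤-Reasoning

  p≤p+q : ∀ p {q} → 0ℚ ≤ q → p ≤ p + q
  p≤p+q p {q} 0≤q = subst (_≤ p + q) (+-identityʳ p) (+-monoʳ-≤ p 0≤q)

  sumℚ-++ : ∀ xs ys → sumℚ (xs ++ ys) ≡ sumℚ xs + sumℚ ys
  sumℚ-++ []       ys = sym (+-identityˡ (sumℚ ys))
  sumℚ-++ (x ∷ xs) ys = trans (cong (_+_ x) (sumℚ-++ xs ys)) (sym (+-assoc x (sumℚ xs) (sumℚ ys)))

  sumℚ-const : ∀ {A : Set} x (xs : List A) → sumℚ (map (λ _ → x) xs) ≡ length xs · x
  sumℚ-const x []       = sym (*-zeroˡ x)
  sumℚ-const x (_ ∷ xs) = begin
    x + sumℚ (map (λ _ → x) xs)     ≡⟨ cong₂ _+_ (*-identityˡ x) (sym (sumℚ-const x xs)) ⟨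
    1ℚ * x + length xs · x          ≡⟨ *-distribʳ-+ x 1ℚ (fromℕ (length xs)) ⟨
    (1ℚ + fromℕ (length xs)) * x    ≡⟨ cong (_* x) (fromℕ-+ 1 (length xs)) ⟨
    suc (length xs) · x             ∎
    where open ≡-Reasoning

  sumℚ-map-nonNeg : ∀ {A : Set} {f : A → ℚ} → (∀ x → 0ℚ ≤ f x) → ∀ xs → 0ℚ ≤ sumℚ (map f xs)
  sumℚ-map-nonNeg f≥0 []       = ≤-refl
  sumℚ-map-nonNeg f≥0 (x ∷ xs) = +-mono-≤ (f≥0 x) (sumℚ-map-nonNeg f≥0 xs)

  sumℚ-map-mono : ∀ {A : Set} {f g : A → ℚ} {xs} → All (λ x → f x ≤ g x) xs → sumℚ (map f xs) ≤ sumℚ (map g xs)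
  sumℚ-map-mono []           = ≤-refl
  sumℚ-map-mono (fx≤gx ∷ le) = +-mono-≤ fx≤gx (sumℚ-map-mono le)

  length·average : ∀ xs → length xs · average xs ≡ sumℚ xs
  length·average []       = refl
  length·average (x ∷ xs) = begin
    fromℕ n * (sumℚ (x ∷ xs) * (+ 1 / n))   ≡⟨ *-comm (fromℕ n) (sumℚ (x ∷ xs) * (+ 1 / n)) ⟩
    sumℚ (x ∷ xs) * (+ 1 / n) * fromℕ n     ≡⟨ *-assoc (sumℚ (x ∷ xs)) _ _ ⟩
    sumℚ (x ∷ xs) * ((+ 1 / n) * fromℕ n)   ≡⟨ cong (sumℚ (x ∷ xs) *_) (/-*-fromℕ 1 (length xs)) ⟩
    sumℚ (x ∷ xs) * 1ℚ                      ≡⟨ *-identityʳ _ ⟩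
    sumℚ (x ∷ xs)                           ∎
    where open ≡-Reasoning
          n : ℕ
          n = suc (length xs)

  average-map-mono : ∀ {A : Set} {f g : A → ℚ} {xs} → All (λ x → f x ≤ g x) xs → average (map f xs) ≤ average (map g xs)
  average-map-mono {xs = []}                 []  = ≤-refl
  average-map-mono {f = f} {g} {xs = x ∷ xs} le rewrite length-map f xs | length-map g xs =
    *-monoʳ-≤-nonNeg (+ 1 / suc (length xs)) {{normalize-nonNeg 1 (suc (length xs))}} (sumℚ-map-mono le)

  ·-average-≤ : ∀ a b (xs ys : List ℚ) → 0 ℕ.< length xs → 0 ℕ.< length ys →
    (a ℕ.* length ys) · sumℚ xs ≤ (b ℕ.* length xs) · sumℚ ys → a · average xs ≤ b · average ys
  ·-average-≤ a b xs ys 0<ℓx 0<ℓy sums≤ = ·-cancelˡ-≤ (ℕ.*-mono-≤ 0<ℓx 0<ℓy) (begin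
    (ℓx ℕ.* ℓy) · a · average xs    ≡⟨ ·-assoc (ℓx ℕ.* ℓy) a (average xs) ⟩
    (ℓx ℕ.* ℓy ℕ.* a) · average xs  ≡⟨ cong (_· average xs) (xy∙z≈zy∙x ℓx ℓy a) ⟩
    (a ℕ.* ℓy ℕ.* ℓx) · average xs  ≡⟨ ·-assoc (a ℕ.* ℓy) ℓx (average xs) ⟨
    (a ℕ.* ℓy) · ℓx · average xs    ≡⟨ cong ((a ℕ.* ℓy) ·_) (length·average xs) ⟩
    (a ℕ.* ℓy) · sumℚ xs            ≤⟨ sums≤ ⟩
    (b ℕ.* ℓx) · sumℚ ys            ≡⟨ cong ((b ℕ.* ℓx) ·_) (length·average ys) ⟨
    (b ℕ.* ℓx) · ℓy · average ys    ≡⟨ ·-assoc (b ℕ.* ℓx) ℓy (average ys) ⟩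
    (b ℕ.* ℓx ℕ.* ℓy) · average ys  ≡⟨ cong (_· average ys) (xy∙z≈yz∙x b ℓx ℓy) ⟩
    (ℓx ℕ.* ℓy ℕ.* b) · average ys  ≡⟨ ·-assoc (ℓx ℕ.* ℓy) b (average ys) ⟨
    (ℓx ℕ.* ℓy) · b · average ys    ∎)
    where
      open ≤-Reasoning
      ℓx ℓy : ℕ
      ℓx = length xs
      ℓy = length ys

  filterᵇ-map : ∀ {A B : Set} (p : B → Bool) (f : A → B) xs → filterᵇ p (map f xs) ≡ map f (filterᵇ (p ∘ f) xs)
  filterᵇ-map p f []       = refl
  filterᵇ-map p f (x ∷ xs) with p (f x)
  ... | true  = cong (f x ∷_) (filterᵇ-map p f xs)
  ... | false = filterᵇ-map p f xs

  filterᵇ-++-map : ∀ {A B : Set} (p : B → Bool) (f g : A → B) xs ys →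
    filterᵇ p (map f xs ++ map g ys) ≡ map f (filterᵇ (p ∘ f) xs) ++ map g (filterᵇ (p ∘ g) ys)
  filterᵇ-++-map p f g xs ys =
    trans (filter-++ (T? ∘ p) (map f xs) (map g ys)) (cong₂ _++_ (filterᵇ-map p f xs) (filterᵇ-map p g ys))

  filterᵇ-cong : ∀ {A : Set} {p q : A → Bool} → (∀ x → p x ≡ q x) → ∀ xs → filterᵇ p xs ≡ filterᵇ q xs
  filterᵇ-cong p≗q = filter-≐ (T? ∘ _) (T? ∘ _) ((λ {x} → subst T (p≗q x)) , (λ {x} → subst T (sym (p≗q x))))

  filterᵇ-true : ∀ {A : Set} (xs : List A) → filterᵇ (λ _ → true) xs ≡ xs
  filterᵇ-true xs = filter-all (T? ∘ λ _ → true) (All.universal _ xs)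

  filterᵇ-false : ∀ {A : Set} (xs : List A) → filterᵇ (λ _ → false) xs ≡ []
  filterᵇ-false xs = filter-none (T? ∘ λ _ → false) (All.universal (λ _ ()) xs)

  allFin-suc : ∀ m → allFin (suc m) ≡ zero ∷ map suc (allFin m)
  allFin-suc m = cong (zero ∷_) (sym (map-tabulate (λ i → i) suc))

  allᵇ-allFin-suc : ∀ {m} (p : Fin (suc m) → Bool) → allᵇ p (allFin (suc m)) ≡ p zero ∧ allᵇ (p ∘ suc) (allFin m)
  allᵇ-allFin-suc {m} p = trans (cong (allᵇ p) (allFin-suc m)) (cong (p zero ∧_) (foldr-map _ suc true (allFin m)))

  allᵇ-true : ∀ {A : Set} (xs : List A) → allᵇ (λ _ → true) xs ≡ true
  allᵇ-true []       = refl
  allᵇ-true (_ ∷ xs) = allᵇ-true xs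

  T-allᵇ⁺ : ∀ {A : Set} {p : A → Bool} {xs} → T (allᵇ p xs) → All (T ∘ p) xs
  T-allᵇ⁺ {xs = []}     _     = []
  T-allᵇ⁺ {xs = x ∷ xs} px∧ps = let px , ps = Equivalence.to T-∧ px∧ps in px ∷ T-allᵇ⁺ ps

  T-allᵇ⁻ : ∀ {A : Set} {p : A → Bool} {xs} → All (T ∘ p) xs → T (allᵇ p xs)
  T-allᵇ⁻ []         = _
  T-allᵇ⁻ (px ∷ pxs) = Equivalence.from T-∧ (px , T-allᵇ⁻ pxs)

  [k+1]*[n+1]C[k+1]≡[n+1]*nCk : ∀ n k → suc k ℕ.* (suc n C suc k) ≡ suc n ℕ.* (n C k)
  [k+1]*[n+1]C[k+1]≡[n+1]*nCk zero    zero    = refl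
  [k+1]*[n+1]C[k+1]≡[n+1]*nCk zero    (suc k) = ℕ.*-zeroʳ (suc (suc k))
  [k+1]*[n+1]C[k+1]≡[n+1]*nCk (suc n) zero    = begin
    1 ℕ.* (suc (suc n) C 1)   ≡⟨ ℕ.*-identityˡ _ ⟩
    suc (suc n) C 1           ≡⟨ nC1≡n (suc (suc n)) ⟩
    suc (suc n)               ≡⟨ ℕ.*-identityʳ (suc (suc n)) ⟨
    suc (suc n) ℕ.* 1         ∎
    where open ≡-Reasoning
  [k+1]*[n+1]C[k+1]≡[n+1]*nCk (suc n) (suc k) = begin
    suc (suc k) ℕ.* (suc (suc n) C suc (suc k))
      ≡⟨ cong (suc (suc k) ℕ.*_) (nCk+nC[k+1]≡[n+1]C[k+1] (suc n) (suc k)) ⟨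
    suc (suc k) ℕ.* (suc n C suc k ℕ.+ suc n C suc (suc k))
      ≡⟨ regroup k (suc n C suc k) (suc n C suc (suc k)) ⟩
    suc n C suc k ℕ.+ (suc k ℕ.* (suc n C suc k) ℕ.+ suc (suc k) ℕ.* (suc n C suc (suc k)))
      ≡⟨ cong (suc n C suc k ℕ.+_) (cong₂ ℕ._+_ ([k+1]*[n+1]C[k+1]≡[n+1]*nCk n k) ([k+1]*[n+1]C[k+1]≡[n+1]*nCk n (suc k))) ⟩
    suc n C suc k ℕ.+ (suc n ℕ.* (n C k) ℕ.+ suc n ℕ.* (n C suc k))
      ≡⟨ cong (suc n C suc k ℕ.+_) (ℕ.*-distribˡ-+ (suc n) (n C k) (n C suc k)) ⟨
    suc n C suc k ℕ.+ suc n ℕ.* (n C k ℕ.+ n C suc k)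
      ≡⟨ cong (λ c → suc n C suc k ℕ.+ suc n ℕ.* c) (nCk+nC[k+1]≡[n+1]C[k+1] n k) ⟩
    suc (suc n) ℕ.* (suc n C suc k)
      ∎
    where
      open ≡-Reasoning
      regroup : ∀ k a b → suc (suc k) ℕ.* (a ℕ.+ b) ≡ a ℕ.+ (suc k ℕ.* a ℕ.+ suc (suc k) ℕ.* b)
      regroup = solve-∀

  [n+1]Ck*[n+1∸k]≡[n+1]*nCk : ∀ n k → (suc n C k) ℕ.* (suc n ℕ.∸ k) ≡ suc n ℕ.* (n C k)
  [n+1]Ck*[n+1∸k]≡[n+1]*nCk n k with k ℕ.≤? n
  ... | yes k≤n = begin
    (suc n C k) ℕ.* (suc n ℕ.∸ k)
      ≡⟨ cong (ℕ._* (suc n ℕ.∸ k)) (nCk≡nC[n∸k] (ℕ.m≤n⇒m≤1+n k≤n)) ⟩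
    (suc n C (suc n ℕ.∸ k)) ℕ.* (suc n ℕ.∸ k)
      ≡⟨ cong (λ d → (suc n C d) ℕ.* d) (ℕ.+-∸-assoc 1 k≤n) ⟩
    (suc n C suc (n ℕ.∸ k)) ℕ.* suc (n ℕ.∸ k)
      ≡⟨ ℕ.*-comm (suc n C suc (n ℕ.∸ k)) (suc (n ℕ.∸ k)) ⟩
    suc (n ℕ.∸ k) ℕ.* (suc n C suc (n ℕ.∸ k))
      ≡⟨ [k+1]*[n+1]C[k+1]≡[n+1]*nCk n (n ℕ.∸ k) ⟩
    suc n ℕ.* (n C (n ℕ.∸ k))
      ≡⟨ cong (suc n ℕ.*_) (nCk≡nC[n∸k] k≤n) ⟨
    suc n ℕ.* (n C k)
      ∎
    where open ≡-Reasoning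
  ... | no k≰n = begin
    (suc n C k) ℕ.* (suc n ℕ.∸ k)   ≡⟨ cong ((suc n C k) ℕ.*_) (ℕ.m≤n⇒m∸n≡0 (ℕ.≰⇒> k≰n)) ⟩
    (suc n C k) ℕ.* 0               ≡⟨ ℕ.*-zeroʳ (suc n C k) ⟩
    0                               ≡⟨ ℕ.*-zeroʳ (suc n) ⟨
    suc n ℕ.* 0                     ≡⟨ cong (suc n ℕ.*_) (k>n⇒nCk≡0 (ℕ.≰⇒> k≰n)) ⟨
    suc n ℕ.* (n C k)               ∎
    where open ≡-Reasoning

  k≤n⇒nCk>0 : ∀ {n k} → k ℕ.≤ n → 0 ℕ.< n C k
  k≤n⇒nCk>0 {n}     {zero}  _         = ℕ.z<s
  k≤n⇒nCk>0 {suc n} {suc k} (s≤s k≤n) =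
    subst (0 ℕ.<_) (nCk+nC[k+1]≡[n+1]C[k+1] n k) (ℕ.<-≤-trans (k≤n⇒nCk>0 k≤n) (ℕ.m≤m+n (n C k) (n C suc k)))

  subsetsOfSize-suc : ∀ m h → subsetsOfSize (suc m) h ≡
    map (true ∷_) (filterᵇ (λ H → suc ∣ H ∣ ℕ.≡ᵇ h) (allSubsets m)) ++ map (false ∷_) (subsetsOfSize m h)
  subsetsOfSize-suc m h = filterᵇ-++-map _ (true ∷_) (false ∷_) (allSubsets m) (allSubsets m)

  subsetsOfSize-suc-zero : ∀ m → subsetsOfSize (suc m) 0 ≡ map (false ∷_) (subsetsOfSize m 0)
  subsetsOfSize-suc-zero m = trans (subsetsOfSize-suc m 0)
    (cong (λ xs → map (true ∷_) xs ++ map (false ∷_) (subsetsOfSize m 0)) (filterᵇ-false (allSubsets m)))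

  subsetsOfSize-suc-suc : ∀ m k → subsetsOfSize (suc m) (suc k) ≡
    map (true ∷_) (subsetsOfSize m k) ++ map (false ∷_) (subsetsOfSize m (suc k))
  subsetsOfSize-suc-suc m k = subsetsOfSize-suc m (suc k)

  length-subsetsOfSize : ∀ m k → length (subsetsOfSize m k) ≡ m C k
  length-subsetsOfSize zero    zero    = refl
  length-subsetsOfSize zero    (suc k) = refl
  length-subsetsOfSize (suc m) zero    = begin
    length (subsetsOfSize (suc m) 0)                ≡⟨ cong length (subsetsOfSize-suc-zero m) ⟩
    length (map (false ∷_) (subsetsOfSize m 0))     ≡⟨ length-map (false ∷_) (subsetsOfSize m 0) ⟩
    length (subsetsOfSize m 0)                      ≡⟨ length-subsetsOfSize m 0 ⟩
    1                                               ∎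
    where open ≡-Reasoning
  length-subsetsOfSize (suc m) (suc k) = begin
    length (subsetsOfSize (suc m) (suc k))
      ≡⟨ cong length (subsetsOfSize-suc-suc m k) ⟩
    length (map (true ∷_) (subsetsOfSize m k) ++ map (false ∷_) (subsetsOfSize m (suc k)))
      ≡⟨ length-++ (map (true ∷_) (subsetsOfSize m k)) ⟩
    length (map (true ∷_) (subsetsOfSize m k)) ℕ.+ length (map (false ∷_) (subsetsOfSize m (suc k)))
      ≡⟨ cong₂ ℕ._+_ (length-map _ (subsetsOfSize m k)) (length-map _ (subsetsOfSize m (suc k))) ⟩
    length (subsetsOfSize m k) ℕ.+ length (subsetsOfSize m (suc k))
      ≡⟨ cong₂ ℕ._+_ (length-subsetsOfSize m k) (length-subsetsOfSize m (suc k)) ⟩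
    m C k ℕ.+ m C suc k
      ≡⟨ nCk+nC[k+1]≡[n+1]C[k+1] m k ⟩
    suc m C suc k
      ∎
    where open ≡-Reasoning

  ∈-subsetsOfSize⁻ : ∀ {m k} {H : Subset m} → H ∈ subsetsOfSize m k → ∣ H ∣ ≡ k
  ∈-subsetsOfSize⁻ {m} {k} H∈ =
    ℕ.≡ᵇ⇒≡ _ k (proj₂ (∈-filter⁻ (T? ∘ λ H → ∣ H ∣ ℕ.≡ᵇ k) {xs = allSubsets m} H∈))

  filterᵇ-eventO-zero : ∀ {m} (Hs : List (Subset m)) → filterᵇ (eventO 0) Hs ≡ Hs
  filterᵇ-eventO-zero {m} Hs = trans (filterᵇ-cong (λ _ → allᵇ-true (allFin m)) Hs) (filterᵇ-true Hs)

  filterᵇ-eventH-zero : ∀ {m} (Hs : List (Subset m)) → filterᵇ (eventH 0) Hs ≡ Hs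
  filterᵇ-eventH-zero {m} Hs = trans (filterᵇ-cong (λ _ → allᵇ-true (allFin m)) Hs) (filterᵇ-true Hs)

  eventO-false∷ : ∀ {m} j (H : Subset m) → eventO (suc j) (false ∷ H) ≡ eventO j H
  eventO-false∷ j H = allᵇ-allFin-suc (λ i → if toℕ i ℕ.<ᵇ suc j then not (lookup (false ∷ H) i) else true)

  eventH-true∷ : ∀ {m} j (H : Subset m) → eventH (suc j) (true ∷ H) ≡ eventH j H
  eventH-true∷ j H = allᵇ-allFin-suc (λ i → if toℕ i ℕ.<ᵇ suc j then lookup (true ∷ H) i else true)

  filterᵇ-eventO-suc : ∀ m h j → filterᵇ (eventO (suc j)) (subsetsOfSize (suc m) h) ≡
    map (false ∷_) (filterᵇ (eventO j) (subsetsOfSize m h))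
  filterᵇ-eventO-suc m h j = begin
    filterᵇ (eventO (suc j)) (subsetsOfSize (suc m) h)
      ≡⟨ cong (filterᵇ (eventO (suc j))) (subsetsOfSize-suc m h) ⟩
    filterᵇ (eventO (suc j)) (map (true ∷_) bigger ++ map (false ∷_) Hs)
      ≡⟨ filterᵇ-++-map (eventO (suc j)) (true ∷_) (false ∷_) bigger Hs ⟩
    map (true ∷_) (filterᵇ (λ _ → false) bigger) ++ map (false ∷_) (filterᵇ (eventO (suc j) ∘ (false ∷_)) Hs)
      ≡⟨ cong₂ (λ xs ys → map (true ∷_) xs ++ map (false ∷_) ys)
               (filterᵇ-false bigger) (filterᵇ-cong (eventO-false∷ j) Hs) ⟩
    map (false ∷_) (filterᵇ (eventO j) Hs)
      ∎
    where
      open ≡-Reasoning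
      Hs bigger : List (Subset m)
      Hs = subsetsOfSize m h
      bigger = filterᵇ (λ H → suc ∣ H ∣ ℕ.≡ᵇ h) (allSubsets m)

  filterᵇ-eventH-suc : ∀ m k j → filterᵇ (eventH (suc j)) (subsetsOfSize (suc m) (suc k)) ≡
    map (true ∷_) (filterᵇ (eventH j) (subsetsOfSize m k))
  filterᵇ-eventH-suc m k j = begin
    filterᵇ (eventH (suc j)) (subsetsOfSize (suc m) (suc k))
      ≡⟨ cong (filterᵇ (eventH (suc j))) (subsetsOfSize-suc-suc m k) ⟩
    filterᵇ (eventH (suc j)) (map (true ∷_) Hs ++ map (false ∷_) bigger)
      ≡⟨ filterᵇ-++-map (eventH (suc j)) (true ∷_) (false ∷_) Hs bigger ⟩
    map (true ∷_) (filterᵇ (eventH (suc j) ∘ (true ∷_)) Hs) ++ map (false ∷_) (filterᵇ (λ _ → false) bigger)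
      ≡⟨ cong₂ (λ xs ys → map (true ∷_) xs ++ map (false ∷_) ys)
               (filterᵇ-cong (eventH-true∷ j) Hs) (filterᵇ-false bigger) ⟩
    map (true ∷_) (filterᵇ (eventH j) Hs) ++ []
      ≡⟨ ++-identityʳ _ ⟩
    map (true ∷_) (filterᵇ (eventH j) Hs)
      ∎
    where
      open ≡-Reasoning
      Hs bigger : List (Subset m)
      Hs = subsetsOfSize m k
      bigger = subsetsOfSize m (suc k)

  -- OPT and the best online candidate

  Antitone : ∀ {m} → (Fin m → ℚ) → Set
  Antitone α = ∀ i j → toℕ i ℕ.≤ toℕ j → α j ≤ α i

  firstOutside : ∀ {m} → (Fin m → ℚ) → Subset m → ℚ
  firstOutside α []          = 0ℚ
  firstOutside α (false ∷ H) = α zero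
  firstOutside α (true ∷ H)  = firstOutside (α ∘ suc) H

  outside-true∷ : ∀ {m} (H : Subset m) → outside (true ∷ H) ≡ map suc (outside H)
  outside-true∷ {m} H =
    trans (cong (filterᵇ (not ∘ lookup (true ∷ H))) (allFin-suc m))
          (filterᵇ-map (not ∘ lookup (true ∷ H)) suc (allFin m))

  outside-false∷ : ∀ {m} (H : Subset m) → outside (false ∷ H) ≡ zero ∷ map suc (outside H)
  outside-false∷ {m} H =
    trans (cong (filterᵇ (not ∘ lookup (false ∷ H))) (allFin-suc m))
          (cong (zero ∷_) (filterᵇ-map (not ∘ lookup (false ∷ H)) suc (allFin m)))

  OPT-≤ : ∀ {m} (α : Fin m → ℚ) {u} → 0ℚ ≤ u → (∀ j → α j ≤ u) → ∀ H → OPT α H ≤ u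
  OPT-≤ α {u} 0≤u α≤u H = foldr-preservesᵇ {P = _≤ u} ⊔-lub 0≤u (map⁺ (All.universal α≤u (outside H)))

  OPT≡firstOutside : ∀ {m} (α : Fin m → ℚ) → (∀ j → 0ℚ ≤ α j) → Antitone α → ∀ H → OPT α H ≡ firstOutside α H
  OPT≡firstOutside α α≥0 anti []          = refl
  OPT≡firstOutside α α≥0 anti (true ∷ H)  = begin
    OPT α (true ∷ H)                   ≡⟨ cong (λ js → foldr _⊔_ 0ℚ (map α js)) (outside-true∷ H) ⟩
    foldr _⊔_ 0ℚ (map α (map suc (outside H)))   ≡⟨ cong (foldr _⊔_ 0ℚ) (map-∘ (outside H)) ⟨
    OPT (α ∘ suc) H                    ≡⟨ OPT≡firstOutside (α ∘ suc) (α≥0 ∘ suc) (λ i j → anti (suc i) (suc j) ∘ s≤s) H ⟩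
    firstOutside (α ∘ suc) H           ∎
    where open ≡-Reasoning
  OPT≡firstOutside α α≥0 anti (false ∷ H) = begin
    OPT α (false ∷ H)                  ≡⟨ cong (λ js → foldr _⊔_ 0ℚ (map α js)) (outside-false∷ H) ⟩
    α zero ⊔ foldr _⊔_ 0ℚ (map α (map suc (outside H)))   ≡⟨ cong (λ q → α zero ⊔ foldr _⊔_ 0ℚ q) (map-∘ (outside H)) ⟨
    α zero ⊔ OPT (α ∘ suc) H           ≡⟨ p≥q⇒p⊔q≡p (OPT-≤ (α ∘ suc) (α≥0 zero) (λ j → anti zero (suc j) z≤n) H) ⟩
    α zero                             ∎
    where open ≡-Reasoning

  condExp-OPT≡average-firstOutside : ∀ {m} h E (α : Fin m → ℚ) → (∀ j → 0ℚ ≤ α j) → Antitone α →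
    condExp m h E (OPT α) ≡ average (map (firstOutside α) (filterᵇ E (subsetsOfSize m h)))
  condExp-OPT≡average-firstOutside h E α α≥0 anti =
    cong average (map-cong (OPT≡firstOutside α α≥0 anti) (filterᵇ E (subsetsOfSize _ h)))

  -- ALG and the candidate just above the best sampled one

  -- α has one more entry than H; read in false ∷ H, firstInside α H is the value of the candidate
  -- ranked immediately above the best member of H.
  firstInside : ∀ {m} → (Fin (suc m) → ℚ) → Subset m → ℚ
  firstInside α []          = 0ℚ
  firstInside α (true ∷ H)  = α zero
  firstInside α (false ∷ H) = firstInside (α ∘ suc) H

  firstInside-spec : ∀ {m} (α : Fin (suc m) → ℚ) (H : Subset m) → 0 ℕ.< ∣ H ∣ →
    ∃₂ λ k k₁ → firstInside α H ≡ α k × toℕ k₁ ≡ suc (toℕ k) × T (lookup (false ∷ H) k₁)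
              × (∀ u → toℕ u ℕ.≤ toℕ k → lookup (false ∷ H) u ≡ false)
  firstInside-spec α (true ∷ H)  _     = zero , suc zero , refl , refl , _ , λ { zero _ → refl }
  firstInside-spec α (false ∷ H) 0<∣H∣ with firstInside-spec (α ∘ suc) H 0<∣H∣
  ... | k , k₁ , value , k₁≡ , k₁∈H , ≤k∉H =
    suc k , suc k₁ , value , cong suc k₁≡ , k₁∈H , λ { zero _ → refl ; (suc u) (s≤s u≤k) → ≤k∉H u u≤k }

  -- An accepted candidate beats k₁ ∈ seen, so it ranks no worse than k; a rejected one ranks below k
  -- (else it would beat all of seen), so the invariant survives until k itself is accepted.
  runAlg-≥ : ∀ {m} (α : Fin m → ℚ) → Antitone α → ∀ {k k₁ : Fin m} seen cs →
    toℕ k₁ ≡ suc (toℕ k) → k₁ ∈ seen → All (λ t → toℕ k ℕ.< toℕ t) seen → k ∈ cs → α k ≤ runAlg α seen cs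
  runAlg-≥ α anti {k} {k₁} seen (c ∷ cs) k₁≡ k₁∈ k<seen k∈c∷cs with isMaxOver c seen in accepted
  ... | true  = anti c k (ℕ.≤-pred (subst (toℕ c ℕ.<_) k₁≡ c<k₁))
    where
      c<k₁ : toℕ c ℕ.< toℕ k₁
      c<k₁ = ℕ.<ᵇ⇒< _ _ (All.lookup (T-allᵇ⁺ (subst T (sym accepted) _)) k₁∈)
  ... | false = runAlg-≥ α anti (c ∷ seen) cs k₁≡ (there k₁∈) (k<c ∷ k<seen) (k∈cs k∈c∷cs)
    where
      k<c : toℕ k ℕ.< toℕ c
      k<c = ℕ.≰⇒> λ c≤k → subst T accepted (T-allᵇ⁻ (All.map (λ k<t → ℕ.<⇒<ᵇ (ℕ.≤-<-trans c≤k k<t)) k<seen))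
      k∈cs : k ∈ c ∷ cs → k ∈ cs
      k∈cs (here refl) = ⊥-elim (ℕ.<-irrefl refl k<c)
      k∈cs (there k∈)  = k∈

  ALG-≥-firstInside : ∀ {m} (α : Fin (suc m) → ℚ) → Antitone α → (H : Subset m) → 0 ℕ.< ∣ H ∣ →
    ∀ {cs} → cs ↭ outside (false ∷ H) → firstInside α H ≤ ALG α (false ∷ H) cs
  ALG-≥-firstInside α anti H 0<∣H∣ {cs} cs↭ with firstInside-spec α H 0<∣H∣
  ... | k , k₁ , value , k₁≡ , k₁∈H , ≤k∉H =
    subst (_≤ ALG α (false ∷ H) cs) (sym value) (runAlg-≥ α anti (inside (false ∷ H)) cs k₁≡ k₁∈seen k<seen k∈cs)
    where
      k₁∈seen : k₁ ∈ inside (false ∷ H)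
      k₁∈seen = ∈-filter⁺ (T? ∘ lookup (false ∷ H)) (∈-allFin k₁) k₁∈H
      k<seen : All (λ t → toℕ k ℕ.< toℕ t) (inside (false ∷ H))
      k<seen = All.tabulate λ t∈ → ℕ.≰⇒> λ t≤k →
        subst T (≤k∉H _ t≤k) (proj₂ (∈-filter⁻ (T? ∘ lookup (false ∷ H)) {xs = allFin _} t∈))
      k∈cs : k ∈ cs
      k∈cs = ∈-resp-↭ (↭-sym cs↭)
        (∈-filter⁺ (T? ∘ not ∘ lookup (false ∷ H)) (∈-allFin k) (subst (T ∘ not) (sym (≤k∉H k ℕ.≤-refl)) _))

  average-firstInside≤condExp-ALG : ∀ {m h} j (α : Fin (suc m) → ℚ) → Antitone α →
    (σ : Subset (suc m) → List (Fin (suc m))) → (∀ H → ∣ H ∣ ≡ suc h → σ H ↭ outside H) →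
    average (map (firstInside α) (filterᵇ (eventO j) (subsetsOfSize m (suc h))))
      ≤ condExp (suc m) (suc h) (eventO (suc j)) (λ H → ALG α H (σ H))
  average-firstInside≤condExp-ALG {m} {h} j α anti σ σ↭ = begin
    average (map (firstInside α) sampled)
      ≤⟨ average-map-mono (All.tabulate ALG-bound) ⟩
    average (map (λ H → ALG α (false ∷ H) (σ (false ∷ H))) sampled)
      ≡⟨ cong average (trans (map-∘ sampled) (cong (map (λ H → ALG α H (σ H))) (sym (filterᵇ-eventO-suc m (suc h) j)))) ⟩
    condExp (suc m) (suc h) (eventO (suc j)) (λ H → ALG α H (σ H))
      ∎
    where
      open ≤-Reasoning
      sampled : List (Subset m)
      sampled = filterᵇ (eventO j) (subsetsOfSize m (suc h))
      ALG-bound : ∀ {H} → H ∈ sampled → firstInside α H ≤ ALG α (false ∷ H) (σ (false ∷ H))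
      ALG-bound {H} H∈ = ALG-≥-firstInside α anti H (subst (0 ℕ.<_) (sym ∣H∣≡1+h) ℕ.z<s) (σ↭ (false ∷ H) ∣H∣≡1+h)
        where
          ∣H∣≡1+h : ∣ H ∣ ≡ suc h
          ∣H∣≡1+h = ∈-subsetsOfSize⁻ (proj₁ (∈-filter⁻ (T? ∘ eventO j) H∈))

  -- The averaged inequality

  ΣfirstOutside : ∀ m → ℕ → (Fin m → ℚ) → ℚ
  ΣfirstOutside m k α = sumℚ (map (firstOutside α) (subsetsOfSize m k))

  ΣfirstInside : ∀ m → ℕ → (Fin (suc m) → ℚ) → ℚ
  ΣfirstInside m h α = sumℚ (map (firstInside α) (subsetsOfSize m h))

  sumℚ-map-subsetsOfSize-suc-suc : ∀ m k (F : Subset (suc m) → ℚ) → sumℚ (map F (subsetsOfSize (suc m) (suc k))) ≡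
    sumℚ (map (F ∘ (true ∷_)) (subsetsOfSize m k)) + sumℚ (map (F ∘ (false ∷_)) (subsetsOfSize m (suc k)))
  sumℚ-map-subsetsOfSize-suc-suc m k F = begin
    sumℚ (map F (subsetsOfSize (suc m) (suc k)))
      ≡⟨ cong (sumℚ ∘ map F) (subsetsOfSize-suc-suc m k) ⟩
    sumℚ (map F (map (true ∷_) (subsetsOfSize m k) ++ map (false ∷_) (subsetsOfSize m (suc k))))
      ≡⟨ cong sumℚ (map-++ F (map (true ∷_) (subsetsOfSize m k)) _) ⟩
    sumℚ (map F (map (true ∷_) (subsetsOfSize m k)) ++ map F (map (false ∷_) (subsetsOfSize m (suc k))))
      ≡⟨ sumℚ-++ (map F (map (true ∷_) (subsetsOfSize m k))) _ ⟩
    sumℚ (map F (map (true ∷_) (subsetsOfSize m k))) + sumℚ (map F (map (false ∷_) (subsetsOfSize m (suc k))))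
      ≡⟨ cong₂ (λ xs ys → sumℚ xs + sumℚ ys) (map-∘ (subsetsOfSize m k)) (map-∘ (subsetsOfSize m (suc k))) ⟨
    sumℚ (map (F ∘ (true ∷_)) (subsetsOfSize m k)) + sumℚ (map (F ∘ (false ∷_)) (subsetsOfSize m (suc k)))
      ∎
    where open ≡-Reasoning

  sumℚ-const-subsetsOfSize : ∀ m k x → sumℚ (map (λ _ → x) (subsetsOfSize m k)) ≡ (m C k) · x
  sumℚ-const-subsetsOfSize m k x = trans (sumℚ-const x (subsetsOfSize m k)) (cong (_· x) (length-subsetsOfSize m k))

  ΣfirstOutside-zero : ∀ m α → ΣfirstOutside (suc m) 0 α ≡ (m C 0) · α zero
  ΣfirstOutside-zero m α = begin
    sumℚ (map (firstOutside α) (subsetsOfSize (suc m) 0))          ≡⟨ cong (sumℚ ∘ map (firstOutside α)) (subsetsOfSize-suc-zero m) ⟩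
    sumℚ (map (firstOutside α) (map (false ∷_) (subsetsOfSize m 0))) ≡⟨ cong sumℚ (map-∘ (subsetsOfSize m 0)) ⟨
    sumℚ (map (λ _ → α zero) (subsetsOfSize m 0))                   ≡⟨ sumℚ-const-subsetsOfSize m 0 (α zero) ⟩
    (m C 0) · α zero                                                ∎
    where open ≡-Reasoning

  ΣfirstOutside-suc : ∀ m k α → ΣfirstOutside (suc m) (suc k) α ≡ ΣfirstOutside m k (α ∘ suc) + (m C suc k) · α zero
  ΣfirstOutside-suc m k α = trans (sumℚ-map-subsetsOfSize-suc-suc m k (firstOutside α))
    (cong (_+_ (ΣfirstOutside m k (α ∘ suc))) (sumℚ-const-subsetsOfSize m (suc k) (α zero)))

  ΣfirstInside-suc : ∀ m h α → ΣfirstInside (suc m) (suc h) α ≡ (m C h) · α zero + ΣfirstInside m (suc h) (α ∘ suc)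
  ΣfirstInside-suc m h α = trans (sumℚ-map-subsetsOfSize-suc-suc m h (firstInside α))
    (cong (_+ ΣfirstInside m (suc h) (α ∘ suc)) (sumℚ-const-subsetsOfSize m h (α zero)))

  firstInside-nonNeg : ∀ {m} (α : Fin (suc m) → ℚ) → (∀ j → 0ℚ ≤ α j) → ∀ H → 0ℚ ≤ firstInside α H
  firstInside-nonNeg α α≥0 []          = ≤-refl
  firstInside-nonNeg α α≥0 (true ∷ H)  = α≥0 zero
  firstInside-nonNeg α α≥0 (false ∷ H) = firstInside-nonNeg (α ∘ suc) (α≥0 ∘ suc) H

  ΣfirstInside-nonNeg : ∀ m h α → (∀ j → 0ℚ ≤ α j) → 0ℚ ≤ ΣfirstInside m h α
  ΣfirstInside-nonNeg m h α α≥0 = sumℚ-map-nonNeg (firstInside-nonNeg α α≥0) (subsetsOfSize m h)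

  α₀-coefficient-≤ : ∀ n h k N → n ℕ.+ k ≡ suc (suc N) →
    suc h ℕ.* (suc N C suc h) ℕ.* (suc N C k) ℕ.≤ n ℕ.* (suc (suc N) C k) ℕ.* (N C h)
  α₀-coefficient-≤ n h k N n+k≡ = begin
    suc h ℕ.* (suc N C suc h) ℕ.* (suc N C k)   ≡⟨ cong (ℕ._* (suc N C k)) ([k+1]*[n+1]C[k+1]≡[n+1]*nCk N h) ⟩
    suc N ℕ.* (N C h) ℕ.* (suc N C k)           ≤⟨ ℕ.*-monoˡ-≤ (suc N C k) (ℕ.*-monoˡ-≤ (N C h) (ℕ.n≤1+n (suc N))) ⟩
    suc (suc N) ℕ.* (N C h) ℕ.* (suc N C k)     ≡⟨ xy∙z≈xz∙y (suc (suc N)) (N C h) (suc N C k) ⟩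
    suc (suc N) ℕ.* (suc N C k) ℕ.* (N C h)     ≡⟨ cong (ℕ._* (N C h)) n*C≡ ⟨
    n ℕ.* (suc (suc N) C k) ℕ.* (N C h)         ∎
    where
      open ℕ.≤-Reasoning
      n≡ : n ≡ suc (suc N) ℕ.∸ k
      n≡ = trans (sym (ℕ.m+n∸n≡m n k)) (cong (ℕ._∸ k) n+k≡)
      n*C≡ : n ℕ.* (suc (suc N) C k) ≡ suc (suc N) ℕ.* (suc N C k)
      n*C≡ = begin-equality
        n ℕ.* (suc (suc N) C k)                    ≡⟨ ℕ.*-comm n (suc (suc N) C k) ⟩
        (suc (suc N) C k) ℕ.* n                    ≡⟨ cong ((suc (suc N) C k) ℕ.*_) n≡ ⟩
        (suc (suc N) C k) ℕ.* (suc (suc N) ℕ.∸ k)  ≡⟨ [n+1]Ck*[n+1∸k]≡[n+1]*nCk (suc N) k ⟩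
        suc (suc N) ℕ.* (suc N C k)                ∎

  -- Split off the best candidate α zero on both sides: its weights compare by α₀-coefficient-≤, and the
  -- remaining sums are the induction hypothesis rescaled by (N ∸ h) · (k + 1).
  ΣfirstOutside-≤-ΣfirstInside : ∀ {n h k N} → suc h ℕ.< n → n ℕ.+ k ≡ suc N →
    (α : Fin (suc N) → ℚ) → (∀ j → 0ℚ ≤ α j) →
    (suc h ℕ.* (N C suc h)) · ΣfirstOutside (suc N) k α ≤ (n ℕ.* (suc N C k)) · ΣfirstInside N (suc h) α
  ΣfirstOutside-≤-ΣfirstInside {N = zero} (s≤s (s≤s _)) ()
  ΣfirstOutside-≤-ΣfirstInside {n} {h} {zero} {suc N} h<n n+0≡ α α≥0 = begin
    P · ΣfirstOutside (suc (suc N)) 0 α              ≡⟨ cong (P ·_) (ΣfirstOutside-zero (suc N) α) ⟩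
    P · (suc N C 0) · α zero                         ≤⟨ ·-·-monoˡ-≤ (α zero) (α₀-coefficient-≤ n h 0 N n+0≡) (α≥0 zero) ⟩
    R · (N C h) · α zero                             ≤⟨ ·-monoʳ-≤ R (p≤p+q ((N C h) · α zero) A′≥0) ⟩
    R · ((N C h) · α zero + A′)                      ≡⟨ cong (R ·_) (ΣfirstInside-suc N h α) ⟨
    R · ΣfirstInside (suc N) (suc h) α               ∎
    where
      open ≤-Reasoning
      P R : ℕ
      P = suc h ℕ.* (suc N C suc h)
      R = n ℕ.* (suc (suc N) C 0)
      A′ : ℚ
      A′ = ΣfirstInside N (suc h) (α ∘ suc)
      A′≥0 : 0ℚ ≤ A′
      A′≥0 = ΣfirstInside-nonNeg N (suc h) (α ∘ suc) (α≥0 ∘ suc)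
  ΣfirstOutside-≤-ΣfirstInside {n} {h} {suc k} {suc N} h<n n+k+1≡ α α≥0 = chain
    where
      P R D : ℕ
      P = suc h ℕ.* (suc N C suc h)
      R = n ℕ.* (suc (suc N) C suc k)
      D = N ℕ.∸ h
      B′ A′ : ℚ
      B′ = ΣfirstOutside (suc N) k (α ∘ suc)
      A′ = ΣfirstInside N (suc h) (α ∘ suc)
      n+k≡ : n ℕ.+ k ≡ suc N
      n+k≡ = ℕ.suc-injective (trans (sym (ℕ.+-suc n k)) n+k+1≡)
      α₀-part : P · (suc N C suc k) · α zero ≤ R · (N C h) · α zero
      α₀-part = ·-·-monoˡ-≤ (α zero) (α₀-coefficient-≤ n h (suc k) N n+k+1≡) (α≥0 zero)
      k<D : suc k ℕ.≤ D
      k<D = ℕ.m+n≤o⇒m≤o∸n (suc k) (subst (ℕ._≤ N) (ℕ.+-comm h (suc k))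
        (ℕ.≤-pred (ℕ.≤-pred (subst (suc (suc h) ℕ.+ suc k ℕ.≤_) n+k+1≡ (ℕ.+-monoˡ-≤ (suc k) h<n)))))
      swap-outer : ∀ a b c d → a ℕ.* b ℕ.* (c ℕ.* d) ≡ c ℕ.* a ℕ.* (b ℕ.* d)
      swap-outer a b c d = trans (interchange a b c d) (cong (ℕ._* (b ℕ.* d)) (ℕ.*-comm a c))
      eP≡aP′ : D ℕ.* suc k ℕ.* P ≡ suc N ℕ.* suc k ℕ.* (suc h ℕ.* (N C suc h))
      eP≡aP′ = begin
        D ℕ.* suc k ℕ.* (suc h ℕ.* (suc N C suc h))   ≡⟨ cong (ℕ._* P) (ℕ.*-comm D (suc k)) ⟩
        suc k ℕ.* D ℕ.* (suc h ℕ.* (suc N C suc h))   ≡⟨ interchange (suc k) D (suc h) (suc N C suc h) ⟩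
        suc k ℕ.* suc h ℕ.* (D ℕ.* (suc N C suc h))   ≡⟨ cong (suc k ℕ.* suc h ℕ.*_) (ℕ.*-comm D (suc N C suc h)) ⟩
        suc k ℕ.* suc h ℕ.* ((suc N C suc h) ℕ.* D)   ≡⟨ cong (suc k ℕ.* suc h ℕ.*_) ([n+1]Ck*[n+1∸k]≡[n+1]*nCk N (suc h)) ⟩
        suc k ℕ.* suc h ℕ.* (suc N ℕ.* (N C suc h))   ≡⟨ swap-outer (suc k) (suc h) (suc N) (N C suc h) ⟩
        suc N ℕ.* suc k ℕ.* (suc h ℕ.* (N C suc h))   ∎
        where open ≡-Reasoning
      bQ′≡eR : suc (suc N) ℕ.* D ℕ.* (n ℕ.* (suc N C k)) ≡ D ℕ.* suc k ℕ.* R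
      bQ′≡eR = sym (begin
        D ℕ.* suc k ℕ.* (n ℕ.* (suc (suc N) C suc k))   ≡⟨ interchange D (suc k) n (suc (suc N) C suc k) ⟩
        D ℕ.* n ℕ.* (suc k ℕ.* (suc (suc N) C suc k))   ≡⟨ cong (D ℕ.* n ℕ.*_) ([k+1]*[n+1]C[k+1]≡[n+1]*nCk (suc N) k) ⟩
        D ℕ.* n ℕ.* (suc (suc N) ℕ.* (suc N C k))       ≡⟨ swap-outer D n (suc (suc N)) (suc N C k) ⟩
        suc (suc N) ℕ.* D ℕ.* (n ℕ.* (suc N C k))       ∎)
        where open ≡-Reasoning
      recursive-part : P · B′ ≤ R · A′
      recursive-part = ·-≤-rescale (D ℕ.* suc k) {a = suc N ℕ.* suc k} {b = suc (suc N) ℕ.* D} {x = B′} {y = A′}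
        (ℕ.*-mono-≤ (ℕ.≤-trans (s≤s z≤n) k<D) (s≤s z≤n)) eP≡aP′ bQ′≡eR (ℕ.*-mono-≤ (ℕ.n≤1+n (suc N)) k<D)
        (ΣfirstInside-nonNeg N (suc h) (α ∘ suc) (α≥0 ∘ suc))
        (ΣfirstOutside-≤-ΣfirstInside h<n n+k≡ (α ∘ suc) (α≥0 ∘ suc))
      chain : P · ΣfirstOutside (suc (suc N)) (suc k) α ≤ R · ΣfirstInside (suc N) (suc h) α
      chain = begin
        P · ΣfirstOutside (suc (suc N)) (suc k) α        ≡⟨ cong (P ·_) (ΣfirstOutside-suc (suc N) k α) ⟩
        P · (B′ + (suc N C suc k) · α zero)              ≡⟨ *-distribˡ-+ (fromℕ P) B′ ((suc N C suc k) · α zero) ⟩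
        P · B′ + P · (suc N C suc k) · α zero            ≤⟨ +-mono-≤ recursive-part α₀-part ⟩
        R · A′ + R · (N C h) · α zero                    ≡⟨ +-comm (R · A′) (R · (N C h) · α zero) ⟩
        R · (N C h) · α zero + R · A′                    ≡⟨ *-distribˡ-+ (fromℕ R) ((N C h) · α zero) A′ ⟨
        R · ((N C h) · α zero + A′)                      ≡⟨ cong (R ·_) (ΣfirstInside-suc N h α) ⟨
        R · ΣfirstInside (suc N) (suc h) α               ∎
        where open ≤-Reasoning

  frac*avg-firstOutside≤avg-firstInside : ∀ {n h k N} → suc h ℕ.< n → n ℕ.+ k ≡ suc N →
    (α : Fin (suc N) → ℚ) → (∀ j → 0ℚ ≤ α j) →
    frac (suc h) n * average (map (firstOutside α) (subsetsOfSize (suc N) k))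
      ≤ average (map (firstInside α) (subsetsOfSize N (suc h)))
  frac*avg-firstOutside≤avg-firstInside {n} {h} {k} {N} h<n n+k≡ α α≥0 =
    frac-≤ (suc h) n (ℕ.<-trans ℕ.z<s h<n)
      (·-average-≤ (suc h) n outsideValues insideValues (0<length k≤1+N) (0<length h<N) sums≤)
    where
      outsideValues insideValues : List ℚ
      outsideValues = map (firstOutside α) (subsetsOfSize (suc N) k)
      insideValues  = map (firstInside α) (subsetsOfSize N (suc h))
      length-values : ∀ {A : Set} m l (f : Subset m → A) → length (map f (subsetsOfSize m l)) ≡ m C l
      length-values m l f = trans (length-map f (subsetsOfSize m l)) (length-subsetsOfSize m l)
      0<length : ∀ {m l} {f : Subset m → ℚ} → l ℕ.≤ m → 0 ℕ.< length (map f (subsetsOfSize m l))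
      0<length {m} {l} {f} l≤m = subst (0 ℕ.<_) (sym (length-values m l f)) (k≤n⇒nCk>0 l≤m)
      k≤1+N : k ℕ.≤ suc N
      k≤1+N = subst (k ℕ.≤_) n+k≡ (ℕ.m≤n+m k n)
      h<N : suc h ℕ.≤ N
      h<N = ℕ.≤-pred (subst (suc (suc h) ℕ.≤_) n+k≡ (ℕ.≤-trans h<n (ℕ.m≤m+n n k)))
      sums≤ : (suc h ℕ.* length insideValues) · sumℚ outsideValues ≤ (n ℕ.* length outsideValues) · sumℚ insideValues
      sums≤ = subst₂ (λ ℓI ℓO → (suc h ℕ.* ℓI) · sumℚ outsideValues ≤ (n ℕ.* ℓO) · sumℚ insideValues)
        (sym (length-values N (suc h) (firstInside α))) (sym (length-values (suc N) k (firstOutside α)))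
        (ΣfirstOutside-≤-ΣfirstInside h<n n+k≡ α α≥0)

  -- The sizes enter as equations so that each step of the induction on j can fix them by matching refl.
  frac*avg-firstOutside∣ℋ≤avg-firstInside∣𝒪 : ∀ j {m N n h k K} → m ≡ j ℕ.+ N → K ≡ j ℕ.+ k →
    n ℕ.+ k ≡ suc N → suc h ℕ.< n → (α : Fin (suc m) → ℚ) → (∀ i → 0ℚ ≤ α i) →
    frac (suc h) n * average (map (firstOutside α) (filterᵇ (eventH j) (subsetsOfSize (suc m) K)))
      ≤ average (map (firstInside α) (filterᵇ (eventO j) (subsetsOfSize m (suc h))))
  frac*avg-firstOutside∣ℋ≤avg-firstInside∣𝒪 zero {m} {n = n} {h} {k} refl refl n+k≡ h<n α α≥0 =
    subst₂ (λ xs ys → frac (suc h) n * average xs ≤ average ys)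
      (cong (map (firstOutside α)) (sym (filterᵇ-eventH-zero (subsetsOfSize (suc m) k))))
      (cong (map (firstInside α)) (sym (filterᵇ-eventO-zero (subsetsOfSize m (suc h)))))
      (frac*avg-firstOutside≤avg-firstInside h<n n+k≡ α α≥0)
  frac*avg-firstOutside∣ℋ≤avg-firstInside∣𝒪 (suc j) {N = N} {n} {h} {k} refl refl n+k≡ h<n α α≥0 =
    subst₂ (λ xs ys → frac (suc h) n * average xs ≤ average ys)
      (trans (map-∘ (filterᵇ (eventH j) (subsetsOfSize (suc (j ℕ.+ N)) (j ℕ.+ k))))
        (cong (map (firstOutside α)) (sym (filterᵇ-eventH-suc (suc (j ℕ.+ N)) (j ℕ.+ k) j))))
      (trans (map-∘ (filterᵇ (eventO j) (subsetsOfSize (j ℕ.+ N) (suc h))))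
        (cong (map (firstInside α)) (sym (filterᵇ-eventO-suc (j ℕ.+ N) (suc h) j))))
      (frac*avg-firstOutside∣ℋ≤avg-firstInside∣𝒪 j refl refl n+k≡ h<n (α ∘ suc) (α≥0 ∘ suc))

open import Defs
open import Data.Nat using (ℕ; suc; s≤s; _+_; _<_; _≤_; _∸_)
open import Data.Nat.Properties using (m+[n∸m]≡n; m≤n⇒m≤1+n; +-commutativeSemigroup)
open import Algebra.Properties.CommutativeSemigroup +-commutativeSemigroup using (x∙yz≈y∙xz)
open import Data.Fin using (Fin; toℕ)
open import Data.List using (List)
open import Data.Fin.Subset using (Subset; ∣_∣)
open import Data.Rational using (ℚ; 0ℚ; _*_) renaming (_≤_ to _≤ℚ_)
open import Data.Rational.Properties using (≤-trans; ≤-reflexive)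
open import Relation.Binary.PropositionalEquality using (_≡_; refl; sym; trans; cong)
open import Data.List.Relation.Binary.Permutation.Propositional using (_↭_)

lemma1 : (n h i : ℕ) → 1 < i → i ≤ h → h ≤ n ∸ 1
  → (α : Fin (n + h) → ℚ)
  → (∀ j → 0ℚ ≤ℚ α j)
  → (∀ j k → toℕ j ≤ toℕ k → α k ≤ℚ α j)
  → (σ : Subset (n + h) → List (Fin (n + h)))
  → (∀ H → ∣ H ∣ ≡ h → σ H ↭ outside H)
  → frac h n * condExp (n + h) h (eventH (i ∸ 1)) (OPT α)
    ≤ℚ condExp (n + h) h (eventO i) (λ H → ALG α H (σ H))
lemma1 (suc n) (suc h) (suc j) _ (s≤s j≤h) h<n α α≥0 anti σ σ↭ =
  ≤-trans (≤-reflexive (cong (frac (suc h) (suc n) *_) (condExp-OPT≡average-firstOutside (suc h) (eventH j) α α≥0 anti)))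
    (≤-trans (frac*avg-firstOutside∣ℋ≤avg-firstInside∣𝒪 j m≡j+N 1+h≡j+k refl (s≤s h<n) α α≥0)
             (average-firstInside≤condExp-ALG j α anti σ σ↭))
  where
    k : ℕ
    k = suc h ∸ j
    1+h≡j+k : suc h ≡ j + k
    1+h≡j+k = sym (m+[n∸m]≡n (m≤n⇒m≤1+n j≤h))
    m≡j+N : n + suc h ≡ j + (n + k)
    m≡j+N = trans (cong (n +_) 1+h≡j+k) (x∙yz≈y∙xz n j k)
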